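{- Let $q\geq 2$ be an integer which is not a power of $2$ and not a power of $3$ (i.e. $q\neq 2^n,3^n$ for every positive integer $n$). Then there exists an integer $a$ with $1\leq a<q$ and $\gcd(a,q)=1$ such that $K(a/q)\leq \operatorname{rad}(q)-1$.
   Context: Every rational number $a/q\in(0,1)$ has a finite simple continued fraction expansion $a/q=[a_1,\ldots,a_r]=\cfrac{1}{a_1+\cfrac{1}{a_2+\cdots+\cfrac{1}{a_r}}}$ with positive integers $a_i$, taken with $a_r\geq 2$ (when $r\geq1$ and $a/q\neq 1$). Define $K(a/q)=\max(a_1,\ldots,a_r)$. For a positive integer $n$, $\operatorname{rad}(n)$ denotes the product of the distinct prime numbers dividing $n$. -}

module Defs where

open import Data.Nat using (ℕ; zero; suc; _*_; _/_; _%_; _⊔_)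
open import Data.Nat.Divisibility using (_∣?_)
open import Data.Nat.Primality using (prime?)
open import Data.List using (List; []; _∷_; foldr; filter; upTo)
open import Data.Nat.ListAction using (product)
open import Relation.Nullary.Decidable using (_×-dec_)

-- Partial quotients [a₁, …, aᵣ] of the simple continued fraction of a/q,
-- computed by the Euclidean algorithm: a/q = 1/(⌊q/a⌋ + (q mod a)/a).
-- The first argument is fuel; fuel ≥ q suffices since the denominator
-- strictly decreases at each step.  The expansion stops when the
-- numerator is 0; for 0 < a < q the last quotient is automatically ≥ 2.
cfQuotients : ℕ → ℕ → ℕ → List ℕ
cfQuotients zero    a       q = []
cfQuotients (suc f) zero    q = []
cfQuotients (suc f) (suc a) q = (q / suc a) ∷ cfQuotients f (q % suc a) (suc a)

K : ℕ → ℕ → ℕ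
K a q = foldr _⊔_ 0 (cfQuotients q a q)

rad : ℕ → ℕ
rad n = product (filter (λ p → prime? p ×-dec (p ∣? n)) (upTo (suc n)))

{-# OPTIONS --safe #-}
-- If a/q = [a₁, …, aᵣ], then q = K(a₁, …, aᵣ) and a = K(a₂, …, aᵣ) for the continuant K, so it
-- suffices to write q as the continuant of a word with letters in [1, B], B = rad q − 1, whose
-- last letter is ≥ 2.  K(w) is the top-left entry of the product of the matrices [[x,1],[1,0]]
-- over the letters x of w, and reversing w transposes that product; this gives, with ũ the
-- reversal of u,
--   K(u, m+2, m, ũ) = K(u, m+1)²   and   K(u, m+1, y, 1, m, ũ) = (1+y) K(u, m+1)².
-- Hence if t is the continuant of a word whose two end letters lie in [2, B), so is Y t² for
-- every 1 ≤ Y ≤ B + 1.  Every divisor s ≥ 2 of q is Y t² with Y squarefree, so Y ∣ rad q and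
-- Y ≤ B + 1; strong induction on s then covers all divisors, with small explicit words for the
-- squarefree base cases and for t ∈ {2, 3, 4, 6}.  The hypotheses on q give rad q ≥ 5 (and ≥ 6
-- when 2 or 3 divides q), which leaves room for those words, and exclude q ∈ {2, 3, 4};
-- for q = 6 one takes 5/6 = [1, 5].
module Submission where

open import Defs
open import Data.Nat
open import Data.Nat.Properties
open import Data.Nat.DivMod
open import Data.Nat.Divisibility
open import Data.Nat.Coprimality using (Coprime; coprime⇒gcd≡1)
open import Data.Nat.GCD using (gcd)
open import Data.Nat.Primality
open import Data.Nat.Primality.Factorisation using (factorise)
open import Data.Nat.Induction using (<-rec)
open import Data.Nat.ListAction using (product)
open import Data.Nat.ListAction.Properties using (∈⇒∣product)
open import Data.Nat.Tactic.RingSolver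
open import Data.List using (List; []; _∷_; [_]; _++_; _∷ʳ_; reverse; length; upTo)
open import Data.List.Properties using (++-assoc; ∷ʳ-++; unfold-reverse; reverse-++; foldr-preservesᵇ)
open import Data.List.Membership.Propositional.Properties using (∈-filter⁺; ∈-upTo⁺)
open import Data.List.Relation.Unary.All as All using (All; []; _∷_; all?)
open import Data.List.Relation.Unary.All.Properties using (++⁺; ∷ʳ⁺; all-filter)
open import Data.Product using (Σ; ∃; ∃₂; _×_; _,_; proj₁; proj₂)
open import Data.Sum as Sum using (_⊎_; inj₁; inj₂; [_,_]′)
open import Data.Empty using (⊥-elim)
open import Relation.Nullary using (¬_; yes; no)
open import Relation.Nullary.Decidable using (Dec; True; toWitness; toWitnessFalse; _×-dec_)
open import Relation.Binary.PropositionalEquality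
  using (_≡_; _≢_; refl; sym; trans; cong; cong₂; subst; subst₂; module ≡-Reasoning)

continuant : List ℕ → ℕ
continuant []           = 1
continuant (x ∷ [])     = x
continuant (x ∷ y ∷ ys) = x * continuant (y ∷ ys) + continuant ys

record Mat₂ : Set where
  constructor ⟨_,_,_,_⟩
  field m₁₁ m₁₂ m₂₁ m₂₂ : ℕ
open Mat₂

infixl 7 _⊗_
_⊗_ : Mat₂ → Mat₂ → Mat₂
⟨ a , b , c , d ⟩ ⊗ ⟨ a′ , b′ , c′ , d′ ⟩ =
  ⟨ a * a′ + b * c′ , a * b′ + b * d′ , c * a′ + d * c′ , c * b′ + d * d′ ⟩

I : Mat₂
I = ⟨ 1 , 0 , 0 , 1 ⟩

infix 8 _ᵀ
_ᵀ : Mat₂ → Mat₂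
⟨ a , b , c , d ⟩ ᵀ = ⟨ a , c , b , d ⟩

M : ℕ → Mat₂
M x = ⟨ x , 1 , 1 , 0 ⟩

mat : List ℕ → Mat₂
mat []       = I
mat (x ∷ xs) = M x ⊗ mat xs

⟨⟩-cong : ∀ {a b c d a′ b′ c′ d′} → a ≡ a′ → b ≡ b′ → c ≡ c′ → d ≡ d′ →
          ⟨ a , b , c , d ⟩ ≡ ⟨ a′ , b′ , c′ , d′ ⟩
⟨⟩-cong refl refl refl refl = refl

⊗-assoc : ∀ A B C → (A ⊗ B) ⊗ C ≡ A ⊗ (B ⊗ C)
⊗-assoc ⟨ a , b , c , d ⟩ ⟨ a′ , b′ , c′ , d′ ⟩ ⟨ a″ , b″ , c″ , d″ ⟩ =
  ⟨⟩-cong (entry a b a′ b′ c′ d′ a″ c″) (entry a b a′ b′ c′ d′ b″ d″)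
          (entry c d a′ b′ c′ d′ a″ c″) (entry c d a′ b′ c′ d′ b″ d″)
  where
  entry : ∀ a b a′ b′ c′ d′ x y → (a * a′ + b * c′) * x + (a * b′ + b * d′) * y ≡
                                  a * (a′ * x + b′ * y) + b * (c′ * x + d′ * y)
  entry = solve-∀

⊗-identityˡ : ∀ A → I ⊗ A ≡ A
⊗-identityˡ ⟨ a , b , c , d ⟩ = ⟨⟩-cong (entry a c) (entry b d) (+-identityʳ c) (+-identityʳ d)
  where
  entry : ∀ x y → 1 * x + 0 * y ≡ x
  entry = solve-∀

⊗-identityʳ : ∀ A → A ⊗ I ≡ A
⊗-identityʳ ⟨ a , b , c , d ⟩ = ⟨⟩-cong (entry a b) (entry′ a b) (entry c d) (entry′ c d)
  where
  entry : ∀ x y → x * 1 + y * 0 ≡ x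
  entry = solve-∀
  entry′ : ∀ x y → x * 0 + y * 1 ≡ y
  entry′ = solve-∀

ᵀ-⊗ : ∀ A B → (A ⊗ B) ᵀ ≡ B ᵀ ⊗ A ᵀ
ᵀ-⊗ ⟨ a , b , c , d ⟩ ⟨ a′ , b′ , c′ , d′ ⟩ =
  ⟨⟩-cong (entry a b a′ c′) (entry c d a′ c′) (entry a b b′ d′) (entry c d b′ d′)
  where
  entry : ∀ a b x y → a * x + b * y ≡ x * a + y * b
  entry = solve-∀

mat-++ : ∀ xs ys → mat (xs ++ ys) ≡ mat xs ⊗ mat ys
mat-++ []       ys = sym (⊗-identityˡ (mat ys))
mat-++ (x ∷ xs) ys = trans (cong (M x ⊗_) (mat-++ xs ys)) (sym (⊗-assoc (M x) (mat xs) (mat ys)))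

mat-∷ʳ : ∀ xs x → mat (xs ∷ʳ x) ≡ mat xs ⊗ M x
mat-∷ʳ xs x = trans (mat-++ xs [ x ]) (cong (mat xs ⊗_) (⊗-identityʳ (M x)))

mat-reverse : ∀ xs → mat (reverse xs) ≡ mat xs ᵀ
mat-reverse []       = refl
mat-reverse (x ∷ xs) = begin
  mat (reverse (x ∷ xs))      ≡⟨ cong mat (unfold-reverse x xs) ⟩
  mat (reverse xs ∷ʳ x)       ≡⟨ mat-∷ʳ (reverse xs) x ⟩
  mat (reverse xs) ⊗ M x      ≡⟨ cong (_⊗ M x) (mat-reverse xs) ⟩
  mat xs ᵀ ⊗ M x ᵀ            ≡⟨ ᵀ-⊗ (M x) (mat xs) ⟨
  (M x ⊗ mat xs) ᵀ            ∎
  where open ≡-Reasoning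

m₁₁-mat : ∀ xs → m₁₁ (mat xs) ≡ continuant xs
m₁₁-mat []           = refl
m₁₁-mat (x ∷ [])     = trans (+-identityʳ (x * 1)) (*-identityʳ x)
m₁₁-mat (x ∷ y ∷ ys) = cong₂ (λ u v → x * u + v) (m₁₁-mat (y ∷ ys)) m₂₁-mat
  where
  m₂₁-mat : 1 * m₂₁ (mat (y ∷ ys)) ≡ continuant ys
  m₂₁-mat = trans (*-identityˡ _) (trans (+-identityʳ _) (trans (*-identityˡ _) (m₁₁-mat ys)))

-- (continuant xs , continuant of xs without its last letter)
row : List ℕ → ℕ × ℕ
row xs = m₁₁ (mat xs) , m₁₂ (mat xs)

infixl 7 _·_
_·_ : ℕ × ℕ → ℕ × ℕ → ℕ
(p , p′) · (q , q′) = p * q + p′ * q′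

snoc : ℕ → ℕ × ℕ → ℕ × ℕ
snoc x (p , p′) = x * p + p′ , p

row-∷ʳ : ∀ xs x → row (xs ∷ʳ x) ≡ snoc x (row xs)
row-∷ʳ xs x = trans (cong (λ A → m₁₁ A , m₁₂ A) (mat-∷ʳ xs x)) (row-⊗M (mat xs))
  where
  row-⊗M : ∀ A → (m₁₁ (A ⊗ M x) , m₁₂ (A ⊗ M x)) ≡ snoc x (m₁₁ A , m₁₂ A)
  row-⊗M ⟨ p , p′ , _ , _ ⟩ = cong₂ _,_ (entry₁₁ p p′ x) (entry₁₂ p p′)
    where
    entry₁₁ : ∀ p p′ x → p * x + p′ * 1 ≡ x * p + p′
    entry₁₁ = solve-∀
    entry₁₂ : ∀ p p′ → p * 1 + p′ * 0 ≡ p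
    entry₁₂ = solve-∀

continuant-∷ʳ : ∀ xs x → continuant (xs ∷ʳ x) ≡ proj₁ (snoc x (row xs))
continuant-∷ʳ xs x = trans (sym (m₁₁-mat (xs ∷ʳ x))) (cong proj₁ (row-∷ʳ xs x))

continuant-++-reverse : ∀ xs ys → continuant (xs ++ reverse ys) ≡ row xs · row ys
continuant-++-reverse xs ys = begin
  continuant (xs ++ reverse ys)     ≡⟨ m₁₁-mat (xs ++ reverse ys) ⟨
  m₁₁ (mat (xs ++ reverse ys))      ≡⟨ cong m₁₁ (mat-++ xs (reverse ys)) ⟩
  m₁₁ (mat xs ⊗ mat (reverse ys))   ≡⟨ cong (λ A → m₁₁ (mat xs ⊗ A)) (mat-reverse ys) ⟩
  m₁₁ (mat xs ⊗ mat ys ᵀ)           ≡⟨ m₁₁-⊗ᵀ (mat xs) (mat ys) ⟩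
  row xs · row ys                   ∎
  where
  open ≡-Reasoning
  m₁₁-⊗ᵀ : ∀ A B → m₁₁ (A ⊗ B ᵀ) ≡ (m₁₁ A , m₁₂ A) · (m₁₁ B , m₁₂ B)
  m₁₁-⊗ᵀ ⟨ _ , _ , _ , _ ⟩ ⟨ _ , _ , _ , _ ⟩ = refl

reverse-∷ʳ : ∀ {A : Set} (xs : List A) x → reverse (xs ∷ʳ x) ≡ x ∷ reverse xs
reverse-∷ʳ xs x = reverse-++ xs [ x ]

continuant-square : ∀ u m → continuant (u ++ suc (suc m) ∷ m ∷ reverse u) ≡
                              continuant (u ∷ʳ suc m) * continuant (u ∷ʳ suc m)
continuant-square u m = begin
  continuant (u ++ suc (suc m) ∷ m ∷ reverse u)
    ≡⟨ cong continuant (∷ʳ-++ u (suc (suc m)) (m ∷ reverse u)) ⟨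
  continuant (u ∷ʳ suc (suc m) ++ m ∷ reverse u)
    ≡⟨ cong (λ v → continuant (u ∷ʳ suc (suc m) ++ v)) (reverse-∷ʳ u m) ⟨
  continuant (u ∷ʳ suc (suc m) ++ reverse (u ∷ʳ m))
    ≡⟨ continuant-++-reverse (u ∷ʳ suc (suc m)) (u ∷ʳ m) ⟩
  row (u ∷ʳ suc (suc m)) · row (u ∷ʳ m)
    ≡⟨ cong₂ _·_ (row-∷ʳ u (suc (suc m))) (row-∷ʳ u m) ⟩
  snoc (suc (suc m)) (row u) · snoc m (row u)
    ≡⟨ square-identity (row u) ⟩
  proj₁ (snoc (suc m) (row u)) * proj₁ (snoc (suc m) (row u))
    ≡⟨ cong (λ t → t * t) (continuant-∷ʳ u (suc m)) ⟨
  continuant (u ∷ʳ suc m) * continuant (u ∷ʳ suc m) ∎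
  where
  open ≡-Reasoning
  square-identity : ∀ e → snoc (suc (suc m)) e · snoc m e ≡
                          proj₁ (snoc (suc m) e) * proj₁ (snoc (suc m) e)
  square-identity (p , p′) = poly m p p′
    where
    poly : ∀ m p p′ → (suc (suc m) * p + p′) * (m * p + p′) + p * p ≡
                      (suc m * p + p′) * (suc m * p + p′)
    poly = solve-∀

continuant-fold : ∀ u m y → continuant (u ++ suc m ∷ y ∷ 1 ∷ m ∷ reverse u) ≡
                            suc y * (continuant (u ∷ʳ suc m) * continuant (u ∷ʳ suc m))
continuant-fold u m y = begin
  continuant (u ++ suc m ∷ y ∷ 1 ∷ m ∷ reverse u)
    ≡⟨ cong continuant (∷ʳ-++ u (suc m) (y ∷ 1 ∷ m ∷ reverse u)) ⟨
  continuant (u ∷ʳ suc m ++ y ∷ 1 ∷ m ∷ reverse u)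
    ≡⟨ cong continuant (∷ʳ-++ (u ∷ʳ suc m) y (1 ∷ m ∷ reverse u)) ⟨
  continuant (u ∷ʳ suc m ∷ʳ y ++ 1 ∷ m ∷ reverse u)
    ≡⟨ cong (λ v → continuant (u ∷ʳ suc m ∷ʳ y ++ 1 ∷ v)) (reverse-∷ʳ u m) ⟨
  continuant (u ∷ʳ suc m ∷ʳ y ++ 1 ∷ reverse (u ∷ʳ m))
    ≡⟨ cong (λ v → continuant (u ∷ʳ suc m ∷ʳ y ++ v)) (reverse-∷ʳ (u ∷ʳ m) 1) ⟨
  continuant (u ∷ʳ suc m ∷ʳ y ++ reverse (u ∷ʳ m ∷ʳ 1))
    ≡⟨ continuant-++-reverse (u ∷ʳ suc m ∷ʳ y) (u ∷ʳ m ∷ʳ 1) ⟩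
  row (u ∷ʳ suc m ∷ʳ y) · row (u ∷ʳ m ∷ʳ 1)
    ≡⟨ cong₂ _·_ (trans (row-∷ʳ (u ∷ʳ suc m) y) (cong (snoc y) (row-∷ʳ u (suc m))))
                 (trans (row-∷ʳ (u ∷ʳ m) 1) (cong (snoc 1) (row-∷ʳ u m))) ⟩
  snoc y (snoc (suc m) (row u)) · snoc 1 (snoc m (row u))
    ≡⟨ fold-identity (row u) ⟩
  suc y * (proj₁ (snoc (suc m) (row u)) * proj₁ (snoc (suc m) (row u)))
    ≡⟨ cong (λ t → suc y * (t * t)) (continuant-∷ʳ u (suc m)) ⟨
  suc y * (continuant (u ∷ʳ suc m) * continuant (u ∷ʳ suc m)) ∎
  where
  open ≡-Reasoning
  fold-identity : ∀ e → snoc y (snoc (suc m) e) · snoc 1 (snoc m e) ≡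
                        suc y * (proj₁ (snoc (suc m) e) * proj₁ (snoc (suc m) e))
  fold-identity (p , p′) = poly m y p p′
    where
    poly : ∀ m y p p′ →
      (y * (suc m * p + p′) + p) * (1 * (m * p + p′) + p) + (suc m * p + p′) * (m * p + p′) ≡
      suc y * ((suc m * p + p′) * (suc m * p + p′))
    poly = solve-∀

data CanonicalCF : List ℕ → Set where
  end : ∀ {x} → 2 ≤ x → CanonicalCF [ x ]
  _∷_ : ∀ {x xs} → 1 ≤ x → CanonicalCF xs → CanonicalCF (x ∷ xs)

continuant-pos : ∀ {xs} → CanonicalCF xs → 1 ≤ continuant xs
continuant-pos (end 2≤x)             = ≤-trans (s≤s z≤n) 2≤x
continuant-pos {_ ∷ _ ∷ _} (1≤x ∷ c) = ≤-trans (*-mono-≤ 1≤x (continuant-pos c)) (m≤m+n _ _)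

continuant-tail-pos : ∀ {x xs} → CanonicalCF (x ∷ xs) → 1 ≤ continuant xs
continuant-tail-pos (end _) = s≤s z≤n
continuant-tail-pos (_ ∷ c) = continuant-pos c

continuant-tail< : ∀ {x xs} → CanonicalCF (x ∷ xs) → continuant xs < continuant (x ∷ xs)
continuant-tail< (end 2≤x) = 2≤x
continuant-tail< {x} {y ∷ ys} (1≤x ∷ c) = begin-strict
  continuant (y ∷ ys)                        ≡⟨ *-identityˡ _ ⟨
  1 * continuant (y ∷ ys)                    ≤⟨ *-monoˡ-≤ _ 1≤x ⟩
  x * continuant (y ∷ ys)                    <⟨ m<m+n _ (continuant-tail-pos c) ⟩
  x * continuant (y ∷ ys) + continuant ys    ∎
  where open ≤-Reasoning

[m*n+o]/n≡m : ∀ m {n o} .{{_ : NonZero n}} → o < n → (m * n + o) / n ≡ m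
[m*n+o]/n≡m m {n} {o} o<n = begin
  (m * n + o) / n      ≡⟨ +-distrib-/-∣ˡ o (n∣m*n m) ⟩
  m * n / n + o / n    ≡⟨ cong₂ _+_ (m*n/n≡m m n) (m<n⇒m/n≡0 o<n) ⟩
  m + 0                ≡⟨ +-identityʳ m ⟩
  m                    ∎
  where open ≡-Reasoning

[m*n+o]%n≡o : ∀ m {n o} .{{_ : NonZero n}} → o < n → (m * n + o) % n ≡ o
[m*n+o]%n≡o m {n} {o} o<n = begin
  (m * n + o) % n      ≡⟨ cong (_% n) (+-comm (m * n) o) ⟩
  (o + m * n) % n      ≡⟨ [m+kn]%n≡m%n o m n ⟩
  o % n                ≡⟨ m<n⇒m%n≡m o<n ⟩
  o                    ∎
  where open ≡-Reasoning

cfQuotients-step : ∀ f a q .{{_ : NonZero a}} →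
                   cfQuotients (suc f) a q ≡ q / a ∷ cfQuotients f (q % a) a
cfQuotients-step f (suc a) q = refl

cfQuotients-zero : ∀ f q → cfQuotients f 0 q ≡ []
cfQuotients-zero zero    q = refl
cfQuotients-zero (suc f) q = refl

cfQuotients-continuant : ∀ {x xs} f → CanonicalCF (x ∷ xs) → continuant xs ≤ f →
                         cfQuotients f (continuant xs) (continuant (x ∷ xs)) ≡ x ∷ xs
cfQuotients-continuant {x} {[]} (suc f) (end _) _ =
  cong₂ _∷_ (n/1≡n x) (trans (cong (λ r → cfQuotients f r 1) (n%1≡0 x)) (cfQuotients-zero f 1))
cfQuotients-continuant {x} {y ∷ ys} (suc f) (_ ∷ c) a≤f = begin
  cfQuotients (suc f) a (x * a + r)              ≡⟨ cfQuotients-step f a (x * a + r) ⟩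
  (x * a + r) / a ∷ cfQuotients f ((x * a + r) % a) a
    ≡⟨ cong₂ (λ u v → u ∷ cfQuotients f v a) ([m*n+o]/n≡m x r<a) ([m*n+o]%n≡o x r<a) ⟩
  x ∷ cfQuotients f r a                          ≡⟨ cong (x ∷_) (cfQuotients-continuant f c r≤f) ⟩
  x ∷ y ∷ ys                                     ∎
  where
  open ≡-Reasoning
  a = continuant (y ∷ ys)
  r = continuant ys
  instance
    a≢0 : NonZero a
    a≢0 = >-nonZero (continuant-pos c)
  r<a : r < a
  r<a = continuant-tail< c
  r≤f : r ≤ f
  r≤f = s≤s⁻¹ (≤-trans r<a a≤f)
cfQuotients-continuant {xs = y ∷ ys} zero (_ ∷ c) a≤0 with () ← ≤-trans (continuant-pos c) a≤0

continuant-coprime : ∀ x xs → Coprime (continuant xs) (continuant (x ∷ xs))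
continuant-coprime x []       (d∣1 , _)       = ∣1⇒≡1 d∣1
continuant-coprime x (y ∷ ys) (d∣a , d∣xa+r) =
  continuant-coprime y ys (∣m+n∣m⇒∣n d∣xa+r (∣n⇒∣m*n x d∣a) , d∣a)

Zaremba : ℕ → ℕ → Set
Zaremba B q = Σ ℕ λ a → (1 ≤ a × a < q) × (gcd a q ≡ 1) × (K a q ≤ B)

canonical⇒zaremba : ∀ {B x xs} → CanonicalCF (x ∷ xs) → All (_≤ B) (x ∷ xs) →
                    Zaremba B (continuant (x ∷ xs))
canonical⇒zaremba {B} {x} {xs} c ≤B =
  continuant xs , (continuant-tail-pos c , a<q) , coprime⇒gcd≡1 (continuant-coprime x xs) , K≤B
  where
  a<q = continuant-tail< c
  K≤B : K (continuant xs) (continuant (x ∷ xs)) ≤ B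
  K≤B rewrite cfQuotients-continuant (continuant (x ∷ xs)) c (<⇒≤ a<q) =
    foldr-preservesᵇ ⊔-lub z≤n ≤B

Bounded : ℕ → ℕ → Set
Bounded B x = 1 ≤ x × x ≤ B

End : ℕ → ℕ → Set
End B x = 2 ≤ x × x < B

-- The end letters stay in [2, B) because folding puts last ± 1 into the middle of the new word
-- and makes the first letter its last one.
data Foldable (B s : ℕ) : Set where
  foldable : ∀ {first middle last} → End B first → All (Bounded B) middle → End B last →
             continuant (first ∷ middle ++ [ last ]) ≡ s → Foldable B s

canonical-∷ʳ : ∀ {xs x} → All (1 ≤_) xs → 2 ≤ x → CanonicalCF (xs ∷ʳ x)
canonical-∷ʳ []         2≤x = end 2≤x
canonical-∷ʳ (1≤y ∷ ps) 2≤x = 1≤y ∷ canonical-∷ʳ ps 2≤x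

foldable⇒zaremba : ∀ {B s} → Foldable B s → Zaremba B s
foldable⇒zaremba (foldable (2≤f , f<B) bounded (2≤l , l<B) refl) =
  canonical⇒zaremba (≤-trans (s≤s z≤n) 2≤f ∷ canonical-∷ʳ (All.map proj₁ bounded) 2≤l)
                    (<⇒≤ f<B ∷ ++⁺ (All.map proj₂ bounded) (<⇒≤ l<B ∷ []))

reverse⁺ : ∀ {A : Set} {P : A → Set} {xs} → All P xs → All P (reverse xs)
reverse⁺ []                         = []
reverse⁺ {P = P} {x ∷ xs} (px ∷ pxs) = subst (All P) (sym (unfold-reverse x xs)) (∷ʳ⁺ (reverse⁺ pxs) px)

palindrome-shape : ∀ {A : Set} (x : A) xs ys →
                   x ∷ (xs ++ ys ++ reverse xs) ++ [ x ] ≡ (x ∷ xs) ++ ys ++ reverse (x ∷ xs)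
palindrome-shape x xs ys = cong (x ∷_) (begin
  (xs ++ ys ++ reverse xs) ++ [ x ]   ≡⟨ ++-assoc xs (ys ++ reverse xs) [ x ] ⟩
  xs ++ (ys ++ reverse xs) ++ [ x ]   ≡⟨ cong (xs ++_) (++-assoc ys (reverse xs) [ x ]) ⟩
  xs ++ ys ++ reverse xs ∷ʳ x         ≡⟨ cong (λ v → xs ++ ys ++ v) (unfold-reverse x xs) ⟨
  xs ++ ys ++ reverse (x ∷ xs)        ∎)
  where open ≡-Reasoning

foldable-square : ∀ {B t} → Foldable B t → Foldable B (t * t)
foldable-square (foldable {first} {middle} {suc m} first-end bounded (2≤1+m , 1+m<B) refl) =
  foldable first-end (++⁺ bounded ((s≤s z≤n , 1+m<B) ∷ (s≤s⁻¹ 2≤1+m , ≤-trans (m≤n+m m 2) 1+m<B)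
                                   ∷ reverse⁺ bounded))
           first-end
           (trans (cong continuant (palindrome-shape first middle (suc (suc m) ∷ m ∷ [])))
                  (continuant-square (first ∷ middle) m))

foldable-fold : ∀ {B t y} → 1 ≤ y → y ≤ B → Foldable B t → Foldable B (suc y * (t * t))
foldable-fold {y = y} 1≤y y≤B
              (foldable {first} {middle} {suc m} first-end bounded (2≤1+m , 1+m<B) refl) =
  foldable first-end (++⁺ bounded ((s≤s z≤n , <⇒≤ 1+m<B) ∷ (1≤y , y≤B) ∷ (≤-refl , ≤-trans 1≤y y≤B)
                                   ∷ (s≤s⁻¹ 2≤1+m , ≤-trans (m≤n+m m 2) 1+m<B) ∷ reverse⁺ bounded))
           first-end
           (trans (cong continuant (palindrome-shape first middle (suc m ∷ y ∷ 1 ∷ m ∷ [])))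
                  (continuant-fold (first ∷ middle) m y))

foldable-scale : ∀ {B t Y} → 1 ≤ Y → Y ≤ suc B → Foldable B t → Foldable B (Y * (t * t))
foldable-scale {Y = 1}           _ _  f = subst (Foldable _) (sym (*-identityˡ _)) (foldable-square f)
foldable-scale {Y = suc (suc _)} _ Y≤ f = foldable-fold (s≤s z≤n) (s≤s⁻¹ Y≤) f

WordFits : ℕ → ℕ → List ℕ → ℕ → Set
WordFits B first middle last = End B first × All (Bounded B) middle × End B last

wordFits? : ∀ B first middle last → Dec (WordFits B first middle last)
wordFits? B first middle last = end? first ×-dec all? bounded? middle ×-dec end? last
  where
  end? : ∀ x → Dec (End B x)
  end? x = 2 ≤? x ×-dec x <? B
  bounded? : ∀ x → Dec (Bounded B x)
  bounded? x = 1 ≤? x ×-dec x ≤? B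

foldable-word : ∀ {B} b first middle last → {True (wordFits? b first middle last)} → b ≤ B →
                Foldable B (continuant (first ∷ middle ++ [ last ]))
foldable-word {B} b first middle last {fits} b≤B with toWitness fits
... | first-end , bounded , last-end =
  foldable (widen-end first-end) (All.map widen-bounded bounded) (widen-end last-end) refl
  where
  widen-end : ∀ {x} → End b x → End B x
  widen-end (2≤x , x<b) = 2≤x , <-≤-trans x<b b≤B
  widen-bounded : ∀ {x} → Bounded b x → Bounded B x
  widen-bounded (1≤x , x≤b) = 1≤x , ≤-trans x≤b b≤B

summand≤ : ∀ {x B} z {Y} → Y ≡ x + suc z → Y ≤ suc B → x ≤ B
summand≤ {x} z refl Y≤ = s≤s⁻¹ (<-≤-trans (m<m+n x z<s) Y≤)

-- 2, 3, 4 and 6 are not continuants of any word of length ≥ 2 with both end letters ≥ 2.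
Exceptional : ℕ → Set
Exceptional s = s ≡ 2 ⊎ s ≡ 3 ⊎ s ≡ 4 ⊎ s ≡ 6

pattern is2 = inj₁ refl
pattern is3 = inj₂ (inj₁ refl)
pattern is4 = inj₂ (inj₂ (inj₁ refl))
pattern is6 = inj₂ (inj₂ (inj₂ refl))

foldable-*4 : ∀ {B Y} → 3 ≤ B → 2 ≤ Y → Y ≤ suc B → Foldable B (Y * 4)
foldable-*4 {Y = suc (suc j)} 3≤B (s≤s (s≤s z≤n)) Y≤ =
  foldable (≤-refl , 3≤B) ((s≤s z≤n , s≤s⁻¹ Y≤) ∷ []) (≤-refl , 3≤B) (word j)
  where
  word : ∀ j → 2 * (suc j * 2 + 1) + 2 ≡ suc (suc j) * 4
  word = solve-∀

foldable-*square : ∀ {B m y} → 2 ≤ m → suc m < B → 1 ≤ y → y ≤ B →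
                   Foldable B (suc y * (suc m * suc m))
foldable-*square {m = m} {y} 2≤m 1+m<B 1≤y y≤B =
  foldable (s≤s (≤-trans (s≤s z≤n) 2≤m) , 1+m<B) ((1≤y , y≤B) ∷ (≤-refl , ≤-trans 1≤y y≤B) ∷ [])
           (2≤m , <-trans (n<1+n m) 1+m<B) (continuant-fold [] m y)

data Residue : ℕ → Set where
  2m+1  : ∀ m → Residue (m * 2 + 1)
  4j    : ∀ j → Residue (j * 4)
  8k+2  : ∀ k → Residue (k * 8 + 2)
  8k+6  : ∀ k → Residue (k * 8 + 6)

residue : ∀ n → Residue n
residue 0 = 4j 0
residue 1 = 2m+1 0
residue 2 = 8k+2 0
residue 3 = 2m+1 1
residue 4 = 4j 1
residue 5 = 2m+1 2
residue 6 = 8k+6 0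
residue 7 = 2m+1 3
residue (suc (suc (suc (suc (suc (suc (suc (suc n)))))))) with residue n
... | 2m+1 m = 2m+1 (4 + m)
... | 4j j   = 4j (2 + j)
... | 8k+2 k = 8k+2 (suc k)
... | 8k+6 k = 8k+6 (suc k)

exceptional⊎foldable : ∀ {B Y} → 4 ≤ B → 2 ≤ Y → Y ≤ suc B → Exceptional Y ⊎ Foldable B Y
exceptional⊎foldable {B} {Y} 4≤B 2≤Y Y≤ = go (residue Y) 2≤Y Y≤
  where
  3≤B = ≤-trans (n≤1+n 3) 4≤B
  go : ∀ {Y} → Residue Y → 2 ≤ Y → Y ≤ suc B → Exceptional Y ⊎ Foldable B Y
  go (2m+1 0)             (s≤s ()) _
  go (2m+1 1)             _ _  = inj₁ is3
  go (2m+1 (suc (suc m))) _ Y≤ =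
    inj₂ (foldable {first = 2} {[]} {suc (suc m)}
                   (≤-refl , 3≤B) [] (s≤s (s≤s z≤n) , summand≤ (1 + m) (split m) Y≤)
                   (cong (_+ 1) (*-comm 2 (suc (suc m)))))
    where
    split : ∀ m → suc (suc m) * 2 + 1 ≡ 3 + m + suc (1 + m)
    split = solve-∀
  go (4j 0)               () _
  go (4j 1)               _ _  = inj₁ is4
  go (4j (suc (suc j)))   _ Y≤ =
    inj₂ (foldable-*4 3≤B (s≤s (s≤s z≤n)) (m≤n⇒m≤1+n (summand≤ (5 + 3 * j) (split j) Y≤)))
    where
    split : ∀ j → suc (suc j) * 4 ≡ suc (suc j) + suc (5 + 3 * j)
    split = solve-∀
  go (8k+2 0)             _ _  = inj₁ is2
  go (8k+2 1)             _ _  = inj₂ (foldable-word 4 3 [] 3 4≤B)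
  go (8k+2 (suc (suc k))) _ Y≤ =
    inj₂ (foldable {first = 2} {suc k ∷ 1 ∷ []} {3}
                   (≤-refl , 3≤B)
                   ((s≤s z≤n , summand≤ (16 + 7 * k) (split k) Y≤) ∷ (≤-refl , ≤-trans (s≤s z≤n) 4≤B) ∷ [])
                   (s≤s (s≤s z≤n) , 4≤B) (word k))
    where
    split : ∀ k → suc (suc k) * 8 + 2 ≡ suc k + suc (16 + 7 * k)
    split = solve-∀
    word : ∀ k → 2 * (suc k * 4 + 3) + 4 ≡ suc (suc k) * 8 + 2
    word = solve-∀
  go (8k+6 0)             _ _  = inj₁ is6
  go (8k+6 (suc k))       _ Y≤ =
    inj₂ (foldable {first = 2} {suc k ∷ []} {4}
                   (≤-refl , 3≤B)
                   ((s≤s z≤n , summand≤ (12 + 7 * k) (split k) Y≤) ∷ [])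
                   (s≤s (s≤s z≤n) , summand≤ (8 + 8 * k) (split′ k) Y≤) (word k))
    where
    split : ∀ k → suc k * 8 + 6 ≡ suc k + suc (12 + 7 * k)
    split = solve-∀
    split′ : ∀ k → suc k * 8 + 6 ≡ 5 + suc (8 + 8 * k)
    split′ = solve-∀
    word : ∀ k → 2 * (suc k * 4 + 1) + 4 ≡ suc k * 8 + 6
    word = solve-∀

-- The fold of the one-letter word [t] handles Y ≥ 2 for t = 3, 4 and (when 6 < B) t = 6;
-- the remaining values of Y * t² get explicit words.
exceptional-scale : ∀ {B t Y} → 5 ≤ B → Exceptional t → 1 ≤ Y → Y ≤ suc B →
                    Exceptional (Y * (t * t)) ⊎ Foldable B (Y * (t * t))
exceptional-scale {Y = 1}           _   is2 _ _  = inj₁ is4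
exceptional-scale {Y = suc (suc _)} 5≤B is2 _ Y≤ =
  inj₂ (foldable-*4 (≤-trans (m≤m+n 3 2) 5≤B) (s≤s (s≤s z≤n)) Y≤)
exceptional-scale {Y = 1}           5≤B is3 _ _  = inj₂ (foldable-word 5 4 [] 2 5≤B)
exceptional-scale {Y = suc (suc _)} 5≤B is3 _ Y≤ =
  inj₂ (foldable-*square (s≤s (s≤s z≤n)) (≤-trans (n≤1+n 4) 5≤B) (s≤s z≤n) (s≤s⁻¹ Y≤))
exceptional-scale {Y = 1}           5≤B is4 _ _  = inj₂ (foldable-word 5 2 (3 ∷ []) 2 5≤B)
exceptional-scale {Y = suc (suc _)} 5≤B is4 _ Y≤ =
  inj₂ (foldable-*square (s≤s (s≤s z≤n)) 5≤B (s≤s z≤n) (s≤s⁻¹ Y≤))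
exceptional-scale {Y = 1} 5≤B is6 _ _  = inj₂ (foldable-word 5 3 (3 ∷ 1 ∷ []) 2 5≤B)
exceptional-scale {Y = 2} 5≤B is6 _ _  = inj₂ (foldable-word 5 4 (4 ∷ []) 4 5≤B)
exceptional-scale {Y = 3} 5≤B is6 _ _  = inj₂ (foldable-word 5 4 (1 ∷ 2 ∷ 3 ∷ []) 2 5≤B)
exceptional-scale {Y = 4} 5≤B is6 _ _  = inj₂ (foldable-word 5 4 (1 ∷ 1 ∷ 1 ∷ 4 ∷ []) 2 5≤B)
exceptional-scale {Y = 5} 5≤B is6 _ _  = inj₂ (foldable-word 5 4 (5 ∷ 2 ∷ 1 ∷ []) 2 5≤B)
exceptional-scale {Y = 6} 5≤B is6 _ _  = inj₂ (foldable-word 5 4 (2 ∷ 2 ∷ 4 ∷ []) 2 5≤B)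
exceptional-scale {Y = 7} _   is6 _ Y≤ = inj₂ (foldable-word 6 5 (2 ∷ 1 ∷ 3 ∷ []) 4 (s≤s⁻¹ Y≤))
exceptional-scale {Y = suc (suc (suc (suc (suc (suc (suc (suc y)))))))} _ is6 _ Y≤ =
  inj₂ (foldable-*square (s≤s (s≤s z≤n)) (≤-trans (s≤s (m≤m+n 6 y)) (s≤s⁻¹ Y≤)) (s≤s z≤n) (s≤s⁻¹ Y≤))

∃prime∣ : ∀ {n} → 2 ≤ n → ∃ λ p → Prime p × p ∣ n
∃prime∣ {n@(suc (suc _))} (s≤s (s≤s _)) with factorise n
... | record { factors = [] ; isFactorisation = () }
... | record { factors = p ∷ ps ; isFactorisation = n≡p*ps ; factorsPrime = pr ∷ _ } =
  p , pr , subst (p ∣_) (sym n≡p*ps) (m∣m*n (product ps))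

prime∣prime⇒≡ : ∀ {p r} → Prime p → Prime r → r ∣ p → r ≡ p
prime∣prime⇒≡ pp pr r∣p with prime⇒irreducible pp r∣p
... | inj₁ refl = ⊥-elim (¬prime[1] pr)
... | inj₂ r≡p  = r≡p

prime[3] : Prime 3
prime[3] = toWitness {a? = prime? 3} _

prime∣⇒∣rad : ∀ {p q} → 1 ≤ q → Prime p → p ∣ q → p ∣ rad q
prime∣⇒∣rad {p} {q@(suc _)} _ pr p∣q =
  ∈⇒∣product (∈-filter⁺ (λ p → prime? p ×-dec (p ∣? q)) (∈-upTo⁺ (s≤s (∣⇒≤ p∣q))) (pr , p∣q))

rad-pos : ∀ q → 1 ≤ rad q
rad-pos q = productOfPrimes≥1 (All.map proj₁ (all-filter (λ p → prime? p ×-dec (p ∣? q)) (upTo (suc q))))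

SquareFree : ℕ → Set
SquareFree y = ∀ {p} → Prime p → ¬ (p * p ∣ y)

squarefree⇒pos : ∀ {y} → SquareFree y → 1 ≤ y
squarefree⇒pos {zero}  sf = ⊥-elim (sf prime[2] (4 ∣0))
squarefree⇒pos {suc _} _  = s≤s z≤n

squarefree-decomposition : ∀ {s} → 1 ≤ s → ∃₂ λ Y t → s ≡ Y * (t * t) × SquareFree Y
squarefree-decomposition {s} = <-rec P step s
  where
  P : ℕ → Set
  P s = 1 ≤ s → ∃₂ λ Y t → s ≡ Y * (t * t) × SquareFree Y
  step : ∀ s → (∀ {s′} → s′ < s → P s′) → P s
  step s rec 1≤s with anyUpTo? (λ p → prime? p ×-dec (p * p ∣? s)) (suc s)
  ... | no ∄p = s , 1 , sym (*-identityʳ s) , λ pr pp∣s → ∄p (_ , s≤s (p≤s pr pp∣s) , pr , pp∣s)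
    where
    instance _ = >-nonZero 1≤s
    p≤s : ∀ {p} → Prime p → p * p ∣ s → p ≤ s
    p≤s {p} pr pp∣s = ≤-trans (m≤m*n p p {{prime⇒nonZero pr}}) (∣⇒≤ pp∣s)
  ... | yes (p , _ , pr , pp∣s@(divides s′ s≡s′pp))
    with rec (quotient-< pp∣s) (>-nonZero⁻¹ s′ {{quotient≢0 pp∣s}})
    where
    instance
      _ = >-nonZero 1≤s
      _ = m≢0∧n>1⇒m*n>1 p p {{prime⇒nonZero pr}} {{prime⇒nonTrivial pr}}
  ...   | Y , t , s′≡Ytt , sf =
    Y , t * p , trans s≡s′pp (trans (cong (_* (p * p)) s′≡Ytt) (regroup Y t p)) , sf
    where
    regroup : ∀ Y t p → Y * (t * t) * (p * p) ≡ Y * (t * p * (t * p))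
    regroup = solve-∀

squarefree⇒∣ : ∀ {y m} → SquareFree y → (∀ {p} → Prime p → p ∣ y → p ∣ m) → y ∣ m
squarefree⇒∣ {y} = <-rec P step y
  where
  P : ℕ → Set
  P y = ∀ {m} → SquareFree y → (∀ {p} → Prime p → p ∣ y → p ∣ m) → y ∣ m
  step : ∀ y → (∀ {y′} → y′ < y → P y′) → P y
  step 0 _ sf _ with () ← squarefree⇒pos sf
  step 1 _ _  _ = 1∣ _
  step y@(suc (suc _)) rec {m} sf ∣m with ∃prime∣ {y} (s≤s (s≤s z≤n))
  ... | p , pr , p∣y@(divides y′ y≡y′p) with ∣m pr p∣y
  ...   | divides m′ m≡m′p =
    subst₂ _∣_ (sym y≡y′p) (sym m≡m′p) (*-monoˡ-∣ p (rec (quotient-< p∣y) sf′ ∣m′))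
    where
    instance _ = prime⇒nonTrivial pr
    y′∣y : y′ ∣ y
    y′∣y = divides p (trans y≡y′p (*-comm y′ p))
    sf′ : SquareFree y′
    sf′ r rr∣y′ = sf r (∣-trans rr∣y′ y′∣y)
    ∣m′ : ∀ {r} → Prime r → r ∣ y′ → r ∣ m′
    ∣m′ {r} rr r∣y′ with euclidsLemma m′ p rr (subst (r ∣_) m≡m′p (∣m rr (∣-trans r∣y′ y′∣y)))
    ... | inj₁ r∣m′ = r∣m′
    ... | inj₂ r∣p with refl ← prime∣prime⇒≡ pr rr r∣p =
      ⊥-elim (sf rr (subst (r * r ∣_) (sym y≡y′p) (*-monoˡ-∣ r r∣y′)))

prime-power : ∀ {q p} → 1 ≤ q → (∀ {r} → Prime r → r ∣ q → r ≡ p) → ∃ λ n → q ≡ p ^ n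
prime-power {q@(suc _)} {p} _ only-p with factorise q
... | record { factors = fs ; isFactorisation = q≡∏fs ; factorsPrime = fs-prime } =
  length fs , trans q≡∏fs (product-≡^ (All.tabulate λ f∈fs →
    only-p (All.lookup fs-prime f∈fs) (subst (_ ∣_) (sym q≡∏fs) (∈⇒∣product f∈fs))))
  where
  product-≡^ : ∀ {xs} → All (_≡ p) xs → product xs ≡ p ^ length xs
  product-≡^ []          = refl
  product-≡^ (refl ∷ ps) = cong (p *_) (product-≡^ ps)

5≤rad : ∀ {q} → 2 ≤ q → (∀ n → 1 ≤ n → q ≢ 2 ^ n) → (∀ n → 1 ≤ n → q ≢ 3 ^ n) → 5 ≤ rad q
5≤rad {q} 2≤q ¬2^ ¬3^ with 5 ≤? rad q
... | yes 5≤rad = 5≤rad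
... | no  5≰rad = ⊥-elim (small (rad q) (rad-pos q) (s≤s⁻¹ (≰⇒> 5≰rad)) (prime∣⇒∣rad 1≤q))
  where
  1≤q = ≤-trans (s≤s z≤n) 2≤q
  not-only : ∀ p → (∀ n → 1 ≤ n → q ≢ p ^ n) → ¬ (∀ {r} → Prime r → r ∣ q → r ≡ p)
  not-only p ¬p^ only-p with prime-power 1≤q only-p
  ... | zero  , refl  = <⇒≱ 2≤q ≤-refl
  ... | suc n , q≡p^n = ¬p^ (suc n) (s≤s z≤n) q≡p^n
  small : ∀ R → 1 ≤ R → R ≤ 4 → ¬ (∀ {p} → Prime p → p ∣ q → p ∣ R)
  small 1 _ _ ∣R with p , pr , p∣q ← ∃prime∣ 2≤q = ¬prime[1] (subst Prime (∣1⇒≡1 (∣R pr p∣q)) pr)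
  small 2 _ _ ∣R = not-only 2 ¬2^ λ pr p∣q → prime∣prime⇒≡ prime[2] pr (∣R pr p∣q)
  small 3 _ _ ∣R = not-only 3 ¬3^ λ pr p∣q → prime∣prime⇒≡ prime[3] pr (∣R pr p∣q)
  small 4 _ _ ∣R = not-only 2 ¬2^ λ pr p∣q →
    [ prime∣prime⇒≡ prime[2] pr , prime∣prime⇒≡ prime[2] pr ]′ (euclidsLemma 2 2 pr (∣R pr p∣q))
  small (suc (suc (suc (suc (suc _))))) _ (s≤s (s≤s (s≤s (s≤s ()))))

2∣⊎3∣∧5≤⇒6≤ : ∀ {R} → 2 ∣ R ⊎ 3 ∣ R → 5 ≤ R → 6 ≤ R
2∣⊎3∣∧5≤⇒6≤ d 5≤R with m≤n⇒m<n∨m≡n 5≤R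
... | inj₁ 5<R  = 5<R
... | inj₂ refl = ⊥-elim ([ toWitnessFalse {a? = 2 ∣? 5} _ , toWitnessFalse {a? = 3 ∣? 5} _ ]′ d)

zaremba-6 : Zaremba (rad 6 ∸ 1) 6
zaremba-6 = 5 , (s≤s z≤n , ≤-refl) , refl , ≤-refl

exceptional⇒2∣⊎3∣ : ∀ {t} → Exceptional t → 2 ∣ t ⊎ 3 ∣ t
exceptional⇒2∣⊎3∣ is2 = inj₁ ∣-refl
exceptional⇒2∣⊎3∣ is3 = inj₂ ∣-refl
exceptional⇒2∣⊎3∣ is4 = inj₁ (divides 2 refl)
exceptional⇒2∣⊎3∣ is6 = inj₁ (divides 3 refl)

module _ {q : ℕ} (2≤q : 2 ≤ q) (¬2^ : ∀ n → 1 ≤ n → q ≢ 2 ^ n) (¬3^ : ∀ n → 1 ≤ n → q ≢ 3 ^ n) where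

  private
    B = rad q ∸ 1
    1≤q = ≤-trans (s≤s z≤n) 2≤q
    instance _ = >-nonZero (rad-pos q)

    1+B≡rad : suc B ≡ rad q
    1+B≡rad = suc-pred (rad q)

    4≤B : 4 ≤ B
    4≤B = s≤s⁻¹ (subst (5 ≤_) (sym 1+B≡rad) (5≤rad 2≤q ¬2^ ¬3^))

    exceptional∣⇒5≤B : ∀ {t} → Exceptional t → t ∣ q → 5 ≤ B
    exceptional∣⇒5≤B {t} e t∣q =
      s≤s⁻¹ (subst (6 ≤_) (sym 1+B≡rad) (2∣⊎3∣∧5≤⇒6≤ 2∣⊎3∣rad (5≤rad 2≤q ¬2^ ¬3^)))
      where
      ∣rad : ∀ {p} → Prime p → p ∣ t → p ∣ rad q
      ∣rad pr p∣t = prime∣⇒∣rad 1≤q pr (∣-trans p∣t t∣q)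
      2∣⊎3∣rad = Sum.map (∣rad prime[2]) (∣rad prime[3]) (exceptional⇒2∣⊎3∣ e)

    squarefree∣⇒≤ : ∀ {Y} → SquareFree Y → Y ∣ q → Y ≤ suc B
    squarefree∣⇒≤ sf Y∣q =
      subst (_ ≤_) (sym 1+B≡rad) (∣⇒≤ (squarefree⇒∣ sf λ pr p∣Y → prime∣⇒∣rad 1≤q pr (∣-trans p∣Y Y∣q)))

  divisor-foldable : ∀ {s} → s ∣ q → 2 ≤ s → Exceptional s ⊎ Foldable B s
  divisor-foldable {s} = <-rec P step s
    where
    ExceptionalOrFoldable : ℕ → Set
    ExceptionalOrFoldable s = Exceptional s ⊎ Foldable B s
    P : ℕ → Set
    P s = s ∣ q → 2 ≤ s → ExceptionalOrFoldable s
    step : ∀ s → (∀ {s′} → s′ < s → P s′) → P s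
    step s rec s∣q 2≤s with squarefree-decomposition (≤-trans (s≤s z≤n) 2≤s)
    ... | Y , t , s≡Ytt , sf = subst ExceptionalOrFoldable (sym s≡Ytt) (by-t t s≡Ytt)
      where
      1≤Y = squarefree⇒pos sf
      Y≤ : Y ≤ suc B
      Y≤ = squarefree∣⇒≤ sf (∣-trans (divides (t * t) (trans s≡Ytt (*-comm Y (t * t)))) s∣q)
      scale : ∀ {t} → t ∣ q → ExceptionalOrFoldable t → ExceptionalOrFoldable (Y * (t * t))
      scale t∣q (inj₁ e) = exceptional-scale (exceptional∣⇒5≤B e t∣q) e 1≤Y Y≤
      scale _   (inj₂ f) = inj₂ (foldable-scale 1≤Y Y≤ f)
      by-t : ∀ t → s ≡ Y * (t * t) → ExceptionalOrFoldable (Y * (t * t))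
      by-t 0 s≡0 with () ← ≤-trans 2≤s (≤-reflexive (trans s≡0 (*-zeroʳ Y)))
      by-t 1 s≡Y = subst ExceptionalOrFoldable (sym (*-identityʳ Y))
                         (exceptional⊎foldable 4≤B (subst (2 ≤_) (trans s≡Y (*-identityʳ Y)) 2≤s) Y≤)
      by-t t@(suc (suc _)) s≡Ytt = scale t∣q (rec t<s t∣q (s≤s (s≤s z≤n)))
        where
        t∣q : t ∣ q
        t∣q = ∣-trans (∣n⇒∣m*n Y (m∣m*n t)) (subst (_∣ q) s≡Ytt s∣q)
        t<s : t < s
        t<s = begin-strict
          t            <⟨ m<m*n t t (s≤s (s≤s z≤n)) ⟩
          t * t        ≤⟨ m≤n*m (t * t) Y {{>-nonZero 1≤Y}} ⟩
          Y * (t * t)  ≡⟨ s≡Ytt ⟨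
          s            ∎
          where open ≤-Reasoning

theorem2 : (q : ℕ) → 2 ≤ q →
    ((n : ℕ) → 1 ≤ n → q ≢ 2 ^ n) →
    ((n : ℕ) → 1 ≤ n → q ≢ 3 ^ n) →
    Σ ℕ (λ a → (1 ≤ a × a < q) × (gcd a q ≡ 1) × (K a q ≤ rad q ∸ 1))
theorem2 q 2≤q ¬2^ ¬3^ with divisor-foldable 2≤q ¬2^ ¬3^ ∣-refl 2≤q
... | inj₂ foldable-q = foldable⇒zaremba foldable-q
... | inj₁ is2        = ⊥-elim (¬2^ 1 (s≤s z≤n) refl)
... | inj₁ is3        = ⊥-elim (¬3^ 1 (s≤s z≤n) refl)
... | inj₁ is4        = ⊥-elim (¬2^ 2 (s≤s z≤n) refl)
... | inj₁ is6        = zaremba-6
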